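{- Let $n$ be a positive integer and $x\in\mathbf{F}_{2^n}$. Then there exists $y\in\mathbf{F}_{2^n}$ with $y^2+xy=x^3+1$ (i.e. $(x,y)\in \mathit{Kob}_0(\mathbf{F}_{2^n})$) if and only if $x=0$ or ($x\neq 0$ and $\operatorname{Tr}_n(x)=\operatorname{Tr}_n(x^{ -1})$).
   Context: $\mathbf{F}_{2^n}$ is the field with $2^n$ elements, $\operatorname{Tr}_n(\beta)=\sum_{i=0}^{n-1}\beta^{2^i}$ is the absolute trace. $\mathit{Kob}_0$ is the Koblitz elliptic curve over $\mathbf{F}_2$ given by $y^2+xy=x^3+1$, and $\mathit{Kob}_0(\mathbf{F}_{2^n})$ denotes its set of rational points over $\mathbf{F}_{2^n}$. -}

module Defs where

open import Level using (Level; _⊔_)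
open import Data.Nat using (ℕ; zero; suc; _^_)
open import Data.Fin using (Fin)
open import Data.Product using (∃)
open import Relation.Nullary using (¬_)
open import Relation.Binary.Definitions using (Decidable)
open import Relation.Binary.PropositionalEquality using (_≡_)
open import Algebra.Bundles using (CommutativeRing)

record IsFieldOfOrder2^ {c ℓ} (n : ℕ) (F : CommutativeRing c ℓ) : Set (c ⊔ ℓ) where
  open CommutativeRing F
  field
    1≉0      : ¬ (1# ≈ 0#)
    inverse  : ∀ x → ¬ (x ≈ 0#) → ∃ λ z → x * z ≈ 1#
    char2    : 1# + 1# ≈ 0#
    _≟_      : Decidable _≈_
    enum     : Fin (2 ^ n) → Carrier
    enum-inj : ∀ i j → enum i ≈ enum j → i ≡ j
    enum-sur : ∀ x → ∃ λ i → enum i ≈ x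

module _ {c ℓ} (F : CommutativeRing c ℓ) where
  open CommutativeRing F

  pow : Carrier → ℕ → Carrier
  pow x zero    = 1#
  pow x (suc k) = x * pow x k

  traceUpTo : ℕ → Carrier → Carrier
  traceUpTo zero    x = 0#
  traceUpTo (suc m) x = traceUpTo m x + pow x (2 ^ m)

  Tr : ℕ → Carrier → Carrier
  Tr n x = traceUpTo n x

module Submission where

-- For x ≠ 0 with inverse z, the substitution y = x·t (equivalently t = y·z)
-- turns the curve equation into the Artin–Schreier equation
--     t² + t = x + z².
-- Over F_{2^n} the map t ↦ t² + t has trace zero (since Tr(a²) = Tr(a)),
-- and conversely every c with Tr(c) = 0 is of the form t² + t: given u with
-- Tr(u) = 1, the element  t = Σ_{j<n} Tr_j(c) u^{2^j}  is an explicit root.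
-- As Tr(x + z²) = Tr(x) + Tr(z), the curve has a point above x iff
-- Tr(x) = Tr(x⁻¹); for x = 0 the point (0, 1) lies on the curve.

open import Defs
open import Data.Nat using (ℕ; NonZero)
open import Data.Product using (∃; _×_)
open import Data.Sum using (_⊎_)
open import Relation.Nullary using (¬_)
open import Function.Bundles using (_⇔_)
open import Algebra.Bundles using (CommutativeRing)

open import Level using (_⊔_)
import Data.Nat as ℕ
open import Data.Nat using (zero; suc; _^_; _≤_; _<_; z≤n; s≤s)
import Data.Nat.Properties as ℕₚ
open import Data.Fin using (Fin; zero; suc; punchIn)
import Data.Fin.Properties as Finₚ
open import Data.Fin.Permutation using (Permutation; permutation)
open import Data.Vec.Functional using (removeAt; replicate)
open import Data.Product using (_,_; proj₁; proj₂)
open import Data.Sum using (inj₁; inj₂)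
open import Data.Empty using (⊥-elim)
open import Relation.Binary.Definitions using (Decidable)
open import Relation.Nullary using (yes; no)
open import Relation.Binary.PropositionalEquality as ≡ using (_≡_)
open import Function.Bundles using (mk⇔)
import Algebra.Properties.CommutativeMonoid.Mult as MultProperties
import Algebra.Properties.CommutativeMonoid.Sum as SumProperties

module _ {c ℓ} (F : CommutativeRing c ℓ) where
  open CommutativeRing F hiding (zero)
  open import Relation.Binary.Reasoning.Setoid setoid

  open import Algebra.Solver.Ring.NaturalCoefficients.Default commutativeSemiring
    using (solve; _:=_; _:+_; _:*_)

  open import Algebra.Properties.Ring ring using (-‿distribʳ-*)
  open import Algebra.Properties.Group +-group using (x∙y⁻¹≈ε⇒x≈y)

  -- Powers of the multiplicative monoid, as in the library: k × a = a^k.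
  open MultProperties *-commutativeMonoid
    using (×-homo-+; ×-distrib-+; ×-congʳ) renaming (_×_ to _×*_)
  open SumProperties *-commutativeMonoid
    using (sum-cong-≋; ∑-distrib-+; sum-permute; sum-remove; sum-replicate)
    renaming (sum to ∏)

  infixr 8 _↑_

  _↑_ : Carrier → ℕ → Carrier
  a ↑ k = pow F a k

  tr : ℕ → Carrier → Carrier
  tr = Tr F

  ↑≡×* : ∀ a k → a ↑ k ≡ k ×* a
  ↑≡×* a zero    = ≡.refl
  ↑≡×* a (suc k) = ≡.cong (a *_) (↑≡×* a k)

  ↑-cong : ∀ k {a b} → a ≈ b → a ↑ k ≈ b ↑ k
  ↑-cong k {a} {b} a≈b rewrite ↑≡×* a k | ↑≡×* b k = ×-congʳ k a≈b

  ↑-distrib-* : ∀ a b k → (a * b) ↑ k ≈ a ↑ k * b ↑ k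
  ↑-distrib-* a b k rewrite ↑≡×* (a * b) k | ↑≡×* a k | ↑≡×* b k = ×-distrib-+ a b k

  ↑-2^suc : ∀ a j → a ↑ (2 ^ suc j) ≈ a ↑ (2 ^ j) * a ↑ (2 ^ j)
  ↑-2^suc a j = begin
    a ↑ (2 ^ suc j)               ≡⟨ ≡.cong (a ↑_) (≡.cong (2 ^ j ℕ.+_) (ℕₚ.+-identityʳ (2 ^ j))) ⟩
    a ↑ (2 ^ j ℕ.+ 2 ^ j)         ≡⟨ ↑≡×* a (2 ^ j ℕ.+ 2 ^ j) ⟩
    (2 ^ j ℕ.+ 2 ^ j) ×* a        ≈⟨ ×-homo-+ a (2 ^ j) (2 ^ j) ⟩
    (2 ^ j) ×* a * (2 ^ j) ×* a   ≡⟨ ≡.sym (≡.cong₂ _*_ (↑≡×* a (2 ^ j)) (↑≡×* a (2 ^ j))) ⟩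
    a ↑ (2 ^ j) * a ↑ (2 ^ j)     ∎

  tr-cong : ∀ j {a b} → a ≈ b → tr j a ≈ tr j b
  tr-cong zero    a≈b = refl
  tr-cong (suc j) a≈b = +-cong (tr-cong j a≈b) (↑-cong (2 ^ j) a≈b)

  tr-square-shift : ∀ j a → tr j (a * a) + a ≈ tr (suc j) a
  tr-square-shift zero    a = +-congˡ (sym (*-identityʳ a))
  tr-square-shift (suc j) a = begin
    (tr j (a * a) + (a * a) ↑ (2 ^ j)) + a   ≈⟨ solve 3 (λ s p a → (s :+ p) :+ a := (s :+ a) :+ p) refl _ _ a ⟩
    (tr j (a * a) + a) + (a * a) ↑ (2 ^ j)   ≈⟨ +-cong (tr-square-shift j a) (↑-distrib-* a a (2 ^ j)) ⟩
    tr (suc j) a + a ↑ (2 ^ j) * a ↑ (2 ^ j) ≈⟨ +-congˡ (sym (↑-2^suc a j)) ⟩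
    tr (suc j) a + a ↑ (2 ^ suc j)           ∎

  module _ {x z : Carrier} (xz≈1 : x * z ≈ 1#) where
    private
      xz·xz≈1 : (x * z) * (x * z) ≈ 1#
      xz·xz≈1 = trans (*-cong xz≈1 xz≈1) (*-identityˡ 1#)

    curve⇒artinSchreier : ∀ {y} → y * y + x * y ≈ x * x * x + 1# →
                          (y * z) * (y * z) + y * z ≈ x + z * z
    curve⇒artinSchreier {y} onCurve = begin
      (y * z) * (y * z) + y * z                  ≈⟨ +-congˡ (sym (trans (*-congʳ xz≈1) (*-identityˡ _))) ⟩
      (y * z) * (y * z) + (x * z) * (y * z)      ≈⟨ solve 3 (λ x y z → (y :* z) :* (y :* z) :+ (x :* z) :* (y :* z)
                                                                      := (z :* z) :* (y :* y :+ x :* y)) refl x y z ⟩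
      (z * z) * (y * y + x * y)                  ≈⟨ *-congˡ onCurve ⟩
      (z * z) * (x * x * x + 1#)                 ≈⟨ solve 3 (λ x z o → (z :* z) :* (x :* x :* x :+ o)
                                                                      := ((x :* z) :* (x :* z)) :* x :+ (z :* z) :* o) refl x z 1# ⟩
      ((x * z) * (x * z)) * x + (z * z) * 1#     ≈⟨ +-cong (trans (*-congʳ xz·xz≈1) (*-identityˡ x)) (*-identityʳ _) ⟩
      x + z * z                                  ∎

    artinSchreier⇒curve : ∀ {t} → t * t + t ≈ x + z * z →
                          (x * t) * (x * t) + x * (x * t) ≈ x * x * x + 1#
    artinSchreier⇒curve {t} root = begin
      (x * t) * (x * t) + x * (x * t)  ≈⟨ solve 2 (λ x t → (x :* t) :* (x :* t) :+ x :* (x :* t)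
                                                          := (x :* x) :* (t :* t :+ t)) refl x t ⟩
      (x * x) * (t * t + t)            ≈⟨ *-congˡ root ⟩
      (x * x) * (x + z * z)            ≈⟨ solve 2 (λ x z → (x :* x) :* (x :+ z :* z)
                                                          := x :* x :* x :+ (x :* z) :* (x :* z)) refl x z ⟩
      x * x * x + (x * z) * (x * z)    ≈⟨ +-congˡ xz·xz≈1 ⟩
      x * x * x + 1#                   ∎

  curve-at-zero : ∀ {x} → x ≈ 0# → 1# * 1# + x * 1# ≈ x * x * x + 1#
  curve-at-zero {x} x≈0 = begin
    1# * 1# + x * 1#   ≈⟨ +-cong (*-identityˡ 1#) (*-congʳ x≈0) ⟩
    1# + 0# * 1#       ≈⟨ +-congˡ (zeroˡ 1#) ⟩
    1# + 0#            ≈⟨ +-comm 1# 0# ⟩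
    0# + 1#            ≈⟨ +-congʳ (sym (trans (*-cong (*-congʳ x≈0) x≈0) (zeroʳ _))) ⟩
    x * x * x + 1#     ∎

  sub-add : ∀ x a → (x + - a) + a ≈ x
  sub-add x a = begin
    (x + - a) + a   ≈⟨ +-assoc x (- a) a ⟩
    x + (- a + a)   ≈⟨ +-congˡ (-‿inverseˡ a) ⟩
    x + 0#          ≈⟨ +-identityʳ x ⟩
    x               ∎

  -- 0^k = 0 for k ≥ 1 (witnessed by an element of Fin k).
  ↑-of-zero : ∀ {k a} → Fin k → a ≈ 0# → a ↑ k ≈ a
  ↑-of-zero {suc k} _ a≈0 = trans (*-congʳ a≈0) (trans (zeroˡ _) (sym a≈0))

  ∏-one-exception : ∀ {k} (f : Fin k → Carrier) a i₀ → f i₀ ≈ 1# →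
                    (∀ i → ¬ i ≡ i₀ → f i ≈ a) → ∏ f * a ≈ a ↑ k
  ∏-one-exception {suc k} f a i₀ f≈1 f≈a = begin
    ∏ f * a                          ≈⟨ *-congʳ (sum-remove {i = i₀} f) ⟩
    (f i₀ * ∏ (removeAt f i₀)) * a   ≈⟨ *-congʳ (*-cong f≈1 (sum-cong-≋ (λ j → f≈a (punchIn i₀ j) (Finₚ.punchInᵢ≢i i₀ j)))) ⟩
    (1# * ∏ (replicate k a)) * a     ≈⟨ *-congʳ (trans (*-identityˡ _) (sum-replicate k)) ⟩
    (k ×* a) * a                     ≡⟨ ≡.cong (_* a) (≡.sym (↑≡×* a k)) ⟩
    a ↑ k * a                        ≈⟨ *-comm _ a ⟩
    a ↑ suc k                        ∎

  -- Polynomial functions in Horner form.  Poly d f: f is a polynomial of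
  -- degree ≤ d;  Monic d f: f is a monic polynomial of degree d.
  data Poly : ℕ → (Carrier → Carrier) → Set (c ⊔ ℓ) where
    constant : ∀ {f} k → (∀ x → f x ≈ k) → Poly 0 f
    horner   : ∀ {d f} h k → Poly d h → (∀ x → f x ≈ x * h x + k) → Poly (suc d) f

  data Monic : ℕ → (Carrier → Carrier) → Set (c ⊔ ℓ) where
    one    : ∀ {f} → (∀ x → f x ≈ 1#) → Monic 0 f
    horner : ∀ {d f} h k → Monic d h → (∀ x → f x ≈ x * h x + k) → Monic (suc d) f

  monic-resp : ∀ {d f g} → Monic d f → (∀ x → f x ≈ g x) → Monic d g
  monic-resp (one f≈1)         f≈g = one (λ x → trans (sym (f≈g x)) (f≈1 x))
  monic-resp (horner h k M f≈) f≈g = horner h k M (λ x → trans (sym (f≈g x)) (f≈ x))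

  monic⇒poly : ∀ {d f} → Monic d f → Poly d f
  monic⇒poly (one f≈1)         = constant 1# f≈1
  monic⇒poly (horner h k M f≈) = horner h k (monic⇒poly M) f≈

  monic-+ : ∀ {d e f g} → Monic e f → Poly d g → d < e → Monic e (λ x → f x + g x)
  monic-+ (horner h k M f≈) (constant k′ g≈) _ =
    horner h (k + k′) M (λ x → trans (+-cong (f≈ x) (g≈ x)) (+-assoc _ k k′))
  monic-+ (horner h k M f≈) (horner h′ k′ P g≈) (s≤s d<e) =
    horner (λ x → h x + h′ x) (k + k′) (monic-+ M P d<e) (λ x → trans (+-cong (f≈ x) (g≈ x))
      (solve 5 (λ x a b a′ b′ → (x :* a :+ b) :+ (x :* a′ :+ b′) := x :* (a :+ a′) :+ (b :+ b′)) refl x (h x) k (h′ x) k′))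

  ↑-monic : ∀ k → Monic k (_↑ k)
  ↑-monic zero    = one (λ _ → refl)
  ↑-monic (suc k) = horner (_↑ k) 0# (↑-monic k) (λ x → sym (+-identityʳ _))

  tr-monic : ∀ j → Monic (2 ^ j) (tr (suc j))
  tr-monic j = monic-resp (monic-+ (↑-monic (2 ^ j)) (lower j) (lower<2^j j)) (λ x → +-comm _ _)
    where
      lowerDegree : ℕ → ℕ
      lowerDegree zero    = 0
      lowerDegree (suc j) = 2 ^ j
      lower : ∀ j → Poly (lowerDegree j) (tr j)
      lower zero    = constant 0# (λ _ → refl)
      lower (suc j) = monic⇒poly (tr-monic j)
      lower<2^j : ∀ j → lowerDegree j < 2 ^ j
      lower<2^j zero    = s≤s z≤n
      lower<2^j (suc j) = ℕₚ.^-monoʳ-< 2 (s≤s (s≤s z≤n)) (ℕₚ.n<1+n j)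

  inverse⇒noZeroDivisors : (∀ x → ¬ x ≈ 0# → ∃ λ z → x * z ≈ 1#) →
                           ∀ {u v} → ¬ u ≈ 0# → u * v ≈ 0# → v ≈ 0#
  inverse⇒noZeroDivisors inverse {u} {v} u≉0 uv≈0 with inverse u u≉0
  ... | z , uz≈1 = begin
    v             ≈⟨ sym (*-identityˡ v) ⟩
    1# * v        ≈⟨ *-congʳ (sym uz≈1) ⟩
    (u * z) * v   ≈⟨ solve 3 (λ u z v → (u :* z) :* v := z :* (u :* v)) refl u z v ⟩
    z * (u * v)   ≈⟨ *-congˡ uv≈0 ⟩
    z * 0#        ≈⟨ zeroʳ z ⟩
    0#            ∎

  module IntegralDomain
    (1≉0 : ¬ 1# ≈ 0#)
    (noZeroDivisors : ∀ {u v} → ¬ u ≈ 0# → u * v ≈ 0# → v ≈ 0#)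
    where

    *-cancelʳ-nonzero : ∀ {u v w} → ¬ w ≈ 0# → u * w ≈ v * w → u ≈ v
    *-cancelʳ-nonzero {u} {v} {w} w≉0 uw≈vw = x∙y⁻¹≈ε⇒x≈y u v (noZeroDivisors w≉0 (begin
      w * (u + - v)       ≈⟨ distribˡ w u (- v) ⟩
      w * u + w * - v     ≈⟨ +-cong (*-comm w u) (sym (-‿distribʳ-* w v)) ⟩
      u * w + - (w * v)   ≈⟨ +-congˡ (-‿cong (*-comm w v)) ⟩
      u * w + - (v * w)   ≈⟨ +-congʳ uw≈vw ⟩
      v * w + - (v * w)   ≈⟨ -‿inverseʳ (v * w) ⟩
      0#                  ∎))

    idempotent-nonzero⇒1 : ∀ {e} → e * e ≈ e → ¬ e ≈ 0# → e ≈ 1#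
    idempotent-nonzero⇒1 {e} ee≈e e≉0 = *-cancelʳ-nonzero e≉0 (trans ee≈e (sym (*-identityˡ e)))

    *-nonzero : ∀ {u v} → ¬ u ≈ 0# → ¬ v ≈ 0# → ¬ u * v ≈ 0#
    *-nonzero u≉0 v≉0 uv≈0 = v≉0 (noZeroDivisors u≉0 uv≈0)

    ∏-nonzero : ∀ {k} (f : Fin k → Carrier) → (∀ i → ¬ f i ≈ 0#) → ¬ ∏ f ≈ 0#
    ∏-nonzero {zero}  f f≉0 = 1≉0
    ∏-nonzero {suc k} f f≉0 = *-nonzero (f≉0 zero) (∏-nonzero (λ i → f (suc i)) (λ i → f≉0 (suc i)))

    divide : ∀ {d f} → Monic (suc d) f → ∀ a →
             ∃ λ q → Monic d q × (∀ x → f x ≈ (x + - a) * q x + f a)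
    divide {zero} {f} (horner g k (one g≈1) f≈) a = g , one g≈1 , λ x → sym (begin
      (x + - a) * g x + f a               ≈⟨ +-cong (*-congˡ (g≈1 x)) (trans (f≈ a) (+-congʳ (*-congˡ (g≈1 a)))) ⟩
      (x + - a) * 1# + (a * 1# + k)       ≈⟨ solve 4 (λ d a k o → d :* o :+ (a :* o :+ k)
                                                                 := (d :+ a) :* o :+ k) refl (x + - a) a k 1# ⟩
      ((x + - a) + a) * 1# + k            ≈⟨ +-congʳ (*-cong (sub-add x a) (sym (g≈1 x))) ⟩
      x * g x + k                         ≈⟨ sym (f≈ x) ⟩
      f x                                 ∎)
    divide {suc d} {f} (horner g k M f≈) a with divide M a
    ... | h , Mh , g≈ = (λ x → x * h x + g a) , horner h (g a) Mh (λ _ → refl) , λ x → sym (begin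
      (x + - a) * (x * h x + g a) + f a                       ≈⟨ +-cong (*-congˡ (+-congʳ (*-congʳ (sym (sub-add x a))))) (f≈ a) ⟩
      (x + - a) * (((x + - a) + a) * h x + g a) + (a * g a + k) ≈⟨ solve 5 (λ d a H G k → d :* ((d :+ a) :* H :+ G) :+ (a :* G :+ k)
                                                                            := (d :+ a) :* (d :* H :+ G) :+ k) refl (x + - a) a (h x) (g a) k ⟩
      ((x + - a) + a) * ((x + - a) * h x + g a) + k             ≈⟨ +-congʳ (*-cong (sub-add x a) (sym (g≈ x))) ⟩
      x * g x + k                                             ≈⟨ sym (f≈ x) ⟩
      f x                                                     ∎)

    roots≤degree : ∀ {d f k} → Monic d f → (r : Fin k → Carrier) → (∀ i j → r i ≈ r j → i ≡ j) →
                   (∀ i → f (r i) ≈ 0#) → k ≤ d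
    roots≤degree {k = zero} _ _ _ _ = z≤n
    roots≤degree {k = suc k} (one f≈1) r _ isRoot = ⊥-elim (1≉0 (trans (sym (f≈1 (r zero))) (isRoot zero)))
    roots≤degree {f = f} {k = suc k} M@(horner _ _ _ _) r r-inj isRoot with divide M (r zero)
    ... | q , Mq , f≈ = s≤s (roots≤degree Mq (λ i → r (suc i)) (λ i j ri≈rj → Finₚ.suc-injective (r-inj (suc i) (suc j) ri≈rj)) q-root)
      where
        a = r zero
        q-root : ∀ i → q (r (suc i)) ≈ 0#
        q-root i = noZeroDivisors b-a≉0 (begin
          (b + - a) * q b          ≈⟨ sym (+-identityʳ _) ⟩
          (b + - a) * q b + 0#     ≈⟨ +-congˡ (sym (isRoot zero)) ⟩
          (b + - a) * q b + f a    ≈⟨ sym (f≈ b) ⟩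
          f b                      ≈⟨ isRoot (suc i) ⟩
          0#                       ∎)
          where
            b = r (suc i)
            b-a≉0 : ¬ b + - a ≈ 0#
            b-a≉0 b-a≈0 with r-inj (suc i) zero (x∙y⁻¹≈ε⇒x≈y b a b-a≈0)
            ... | ()

  module Characteristic2 (char2 : 1# + 1# ≈ 0#) where

    x+x≈0 : ∀ w → w + w ≈ 0#
    x+x≈0 w = begin
      w + w             ≈⟨ sym (+-cong (*-identityʳ w) (*-identityʳ w)) ⟩
      w * 1# + w * 1#   ≈⟨ sym (distribˡ w 1# 1#) ⟩
      w * (1# + 1#)     ≈⟨ *-congˡ char2 ⟩
      w * 0#            ≈⟨ zeroʳ w ⟩
      0#                ∎

    drop-double : ∀ {p q} r → p ≈ q + (r + r) → p ≈ q
    drop-double {p} {q} r p≈ = trans p≈ (trans (+-congˡ (x+x≈0 r)) (+-identityʳ q))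

    x+a+a≈x : ∀ x a → (x + a) + a ≈ x
    x+a+a≈x x a = drop-double a (+-assoc x a a)

    move-summand : ∀ {x y} a → x + a ≈ y → x ≈ y + a
    move-summand {x} a x+a≈y = trans (sym (x+a+a≈x x a)) (+-congʳ x+a≈y)

    add-cancelʳ : ∀ {x y} a → x + a ≈ y + a → x ≈ y
    add-cancelʳ {y = y} a x+a≈y+a = trans (move-summand a x+a≈y+a) (x+a+a≈x y a)

    sum≈0⇒≈ : ∀ {x y} → x + y ≈ 0# → x ≈ y
    sum≈0⇒≈ {y = y} x+y≈0 = trans (move-summand y x+y≈0) (+-identityˡ y)

    square-+ : ∀ a b → (a + b) * (a + b) ≈ a * a + b * b
    square-+ a b = drop-double (a * b)
      (solve 2 (λ a b → (a :+ b) :* (a :+ b) := (a :* a :+ b :* b) :+ (a :* b :+ a :* b)) refl a b)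

    ↑2^-+ : ∀ j a b → (a + b) ↑ (2 ^ j) ≈ a ↑ (2 ^ j) + b ↑ (2 ^ j)
    ↑2^-+ zero a b = trans (*-identityʳ _) (sym (+-cong (*-identityʳ a) (*-identityʳ b)))
    ↑2^-+ (suc j) a b = begin
      (a + b) ↑ (2 ^ suc j)                                 ≈⟨ ↑-2^suc (a + b) j ⟩
      (a + b) ↑ (2 ^ j) * (a + b) ↑ (2 ^ j)                 ≈⟨ *-cong (↑2^-+ j a b) (↑2^-+ j a b) ⟩
      (a ↑ (2 ^ j) + b ↑ (2 ^ j)) * (a ↑ (2 ^ j) + b ↑ (2 ^ j)) ≈⟨ square-+ _ _ ⟩
      a ↑ (2 ^ j) * a ↑ (2 ^ j) + b ↑ (2 ^ j) * b ↑ (2 ^ j) ≈⟨ sym (+-cong (↑-2^suc a j) (↑-2^suc b j)) ⟩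
      a ↑ (2 ^ suc j) + b ↑ (2 ^ suc j)                     ∎

    tr-+ : ∀ j a b → tr j (a + b) ≈ tr j a + tr j b
    tr-+ zero    a b = sym (+-identityˡ 0#)
    tr-+ (suc j) a b = trans (+-cong (tr-+ j a b) (↑2^-+ j a b))
      (solve 4 (λ p q r s → (p :+ q) :+ (r :+ s) := (p :+ r) :+ (q :+ s)) refl _ _ _ _)

    tr-squared : ∀ j a → tr j a * tr j a ≈ tr j (a * a)
    tr-squared zero    a = zeroˡ 0#
    tr-squared (suc j) a = trans (square-+ _ _)
      (+-cong (tr-squared j a) (sym (↑-distrib-* a a (2 ^ j))))

    -- An explicit root of the Artin–Schreier equation t² + t = c:  with
    -- t_j = Σ_{i<j} tr_i(c) u^{2^i}  one has
    --   t_j² + t_j = tr_j(c) u^{2^j} + c (tr_j(u) + u^{2^j} + u),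
    -- which equals c once tr_n(c) = 0, tr_n(u) = 1 and u^{2^n} = u.
    module ArtinSchreier (c u : Carrier) where
      root : ℕ → Carrier
      root zero    = 0#
      root (suc j) = root j + tr j c * u ↑ (2 ^ j)

      tr-c-squared : ∀ j → tr j c * tr j c ≈ tr (suc j) c + c
      tr-c-squared j = trans (tr-squared j c) (move-summand c (tr-square-shift j c))

      root-invariant : ∀ j → root j * root j + root j
                             ≈ tr j c * u ↑ (2 ^ j) + c * ((tr j u + u ↑ (2 ^ j)) + u)
      root-invariant zero = begin
        0# * 0# + 0#                         ≈⟨ trans (+-identityʳ _) (zeroˡ 0#) ⟩
        0#                                   ≈⟨ sym (trans (+-cong (zeroˡ _) (trans (*-congˡ u+u≈0) (zeroʳ c))) (+-identityˡ 0#)) ⟩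
        0# * u ↑ 1 + c * ((0# + u ↑ 1) + u)  ∎
        where
          u+u≈0 : (0# + u ↑ 1) + u ≈ 0#
          u+u≈0 = trans (+-congʳ (trans (+-identityˡ _) (*-identityʳ u))) (x+x≈0 u)
      root-invariant (suc j) = begin
        (t + w) * (t + w) + (t + w)          ≈⟨ +-congʳ (square-+ t w) ⟩
        (t * t + w * w) + (t + w)            ≈⟨ solve 2 (λ t w → (t :* t :+ w :* w) :+ (t :+ w) := (t :* t :+ t) :+ (w :* w :+ w)) refl t w ⟩
        (t * t + t) + (w * w + w)            ≈⟨ +-cong (root-invariant j) (+-congʳ w²) ⟩
        (w + c * ((tr j u + U) + u)) + ((tr (suc j) c + c) * U′ + w)
            ≈⟨ drop-double w (solve 7 (λ w T U u A c U′ → (w :+ c :* ((T :+ U) :+ u)) :+ ((A :+ c) :* U′ :+ w)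
                                                        := (A :* U′ :+ c :* (((T :+ U) :+ U′) :+ u)) :+ (w :+ w))
                                         refl w (tr j u) U u (tr (suc j) c) c U′) ⟩
        tr (suc j) c * U′ + c * ((tr (suc j) u + U′) + u) ∎
        where
          t = root j
          U = u ↑ (2 ^ j)
          U′ = u ↑ (2 ^ suc j)
          w = tr j c * U
          w² : w * w ≈ (tr (suc j) c + c) * U′
          w² = begin
            w * w                            ≈⟨ solve 2 (λ a b → (a :* b) :* (a :* b) := (a :* a) :* (b :* b)) refl (tr j c) U ⟩
            (tr j c * tr j c) * (U * U)      ≈⟨ *-cong (tr-c-squared j) (sym (↑-2^suc u j)) ⟩
            (tr (suc j) c + c) * U′          ∎

      root-solves : ∀ n → u ↑ (2 ^ n) ≈ u → tr n u ≈ 1# → tr n c ≈ 0# →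
                    root n * root n + root n ≈ c
      root-solves n frob tr-u≈1 tr-c≈0 = begin
        root n * root n + root n                              ≈⟨ root-invariant n ⟩
        tr n c * u ↑ (2 ^ n) + c * ((tr n u + u ↑ (2 ^ n)) + u) ≈⟨ +-cong (*-cong tr-c≈0 frob) (*-congˡ (+-congʳ (+-cong tr-u≈1 frob))) ⟩
        0# * u + c * ((1# + u) + u)                           ≈⟨ +-cong (zeroˡ u) (*-congˡ (x+a+a≈x 1# u)) ⟩
        0# + c * 1#                                           ≈⟨ trans (+-identityˡ _) (*-identityʳ c) ⟩
        c                                                     ∎

  -- For a ≠ 0, multiplication by a
  -- permutes the nonzero elements, so their product P satisfies
  -- P = a^{q-1} P, and P ≠ 0 can be cancelled.
  module FiniteField
    (1≉0 : ¬ 1# ≈ 0#)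
    (inverse : ∀ x → ¬ x ≈ 0# → ∃ λ z → x * z ≈ 1#)
    (_≟_ : Decidable _≈_)
    {q : ℕ} (enum : Fin q → Carrier)
    (enum-inj : ∀ i j → enum i ≈ enum j → i ≡ j)
    (enum-sur : ∀ x → ∃ λ i → enum i ≈ x)
    where
    open IntegralDomain 1≉0 (inverse⇒noZeroDivisors inverse)

    index : Carrier → Fin q
    index x = proj₁ (enum-sur x)

    enum-index : ∀ x → enum (index x) ≈ x
    enum-index x = proj₂ (enum-sur x)

    scaling : ∀ {a z} → a * z ≈ 1# → Permutation q q
    scaling {a} {z} az≈1 = permutation (scaleBy a) (scaleBy z) (undo az≈1) (undo (trans (*-comm z a) az≈1))
      where
        scaleBy : Carrier → Fin q → Fin q
        scaleBy a i = index (a * enum i)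
        undo : ∀ {a z} → a * z ≈ 1# → ∀ j → scaleBy a (scaleBy z j) ≡ j
        undo {a} {z} az≈1 j = enum-inj _ _ (begin
          enum (scaleBy a (scaleBy z j))   ≈⟨ trans (enum-index _) (*-congˡ (enum-index _)) ⟩
          a * (z * enum j)                 ≈⟨ sym (*-assoc a z _) ⟩
          (a * z) * enum j                 ≈⟨ trans (*-congʳ az≈1) (*-identityˡ _) ⟩
          enum j                           ∎)

    -- nonzeroPart w is w, or 1 if w = 0; scaleFactor a w is the factor by
    -- which it changes when w is multiplied by a ≠ 0.
    nonzeroPart : Carrier → Carrier
    nonzeroPart w with w ≟ 0#
    ... | yes _ = 1#
    ... | no  _ = w

    scaleFactor : Carrier → Carrier → Carrier
    scaleFactor a w with w ≟ 0#
    ... | yes _ = 1#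
    ... | no  _ = a

    nonzeroPart-cong : ∀ {w w′} → w ≈ w′ → nonzeroPart w ≈ nonzeroPart w′
    nonzeroPart-cong {w} {w′} w≈w′ with w ≟ 0# | w′ ≟ 0#
    ... | yes _    | yes _     = refl
    ... | yes w≈0  | no  w′≉0  = ⊥-elim (w′≉0 (trans (sym w≈w′) w≈0))
    ... | no  w≉0  | yes w′≈0  = ⊥-elim (w≉0 (trans w≈w′ w′≈0))
    ... | no  _    | no  _     = w≈w′

    nonzeroPart-nonzero : ∀ w → ¬ nonzeroPart w ≈ 0#
    nonzeroPart-nonzero w with w ≟ 0#
    ... | yes _   = 1≉0
    ... | no  w≉0 = w≉0

    nonzeroPart-scale : ∀ {a} w → ¬ a ≈ 0# → nonzeroPart (a * w) ≈ scaleFactor a w * nonzeroPart w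
    nonzeroPart-scale {a} w a≉0 with w ≟ 0# | (a * w) ≟ 0#
    ... | yes _   | yes _    = sym (*-identityˡ 1#)
    ... | yes w≈0 | no aw≉0  = ⊥-elim (aw≉0 (trans (*-congˡ w≈0) (zeroʳ a)))
    ... | no w≉0  | yes aw≈0 = ⊥-elim (w≉0 (inverse⇒noZeroDivisors inverse a≉0 aw≈0))
    ... | no _    | no _     = refl

    scaleFactor-zero : ∀ {a w} → w ≈ 0# → scaleFactor a w ≈ 1#
    scaleFactor-zero {w = w} w≈0 with w ≟ 0#
    ... | yes _   = refl
    ... | no  w≉0 = ⊥-elim (w≉0 w≈0)

    scaleFactor-nonzero : ∀ {a w} → ¬ w ≈ 0# → scaleFactor a w ≈ a
    scaleFactor-nonzero {w = w} w≉0 with w ≟ 0#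
    ... | yes w≈0 = ⊥-elim (w≉0 w≈0)
    ... | no  _   = refl

    fermat-unit : ∀ a → ¬ a ≈ 0# → a ↑ q ≈ a
    fermat-unit a a≉0 with inverse a a≉0
    ... | z , az≈1 = *-cancelʳ-nonzero P≉0 (begin
      a ↑ q * P     ≈⟨ *-congʳ (sym factors) ⟩
      (K * a) * P   ≈⟨ solve 3 (λ K a P → (K :* a) :* P := a :* (K :* P)) refl K a P ⟩
      a * (K * P)   ≈⟨ *-congˡ (sym permuted) ⟩
      a * P         ∎)
      where
        P = ∏ (λ i → nonzeroPart (enum i))
        K = ∏ (λ i → scaleFactor a (enum i))
        P≉0 : ¬ P ≈ 0#
        P≉0 = ∏-nonzero _ (λ i → nonzeroPart-nonzero (enum i))
        permuted : P ≈ K * P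
        permuted = begin
          P                                                       ≈⟨ sum-permute (λ i → nonzeroPart (enum i)) (scaling az≈1) ⟩
          ∏ (λ i → nonzeroPart (enum (index (a * enum i))))        ≈⟨ sum-cong-≋ (λ i → trans (nonzeroPart-cong (enum-index _))
                                                                                             (nonzeroPart-scale (enum i) a≉0)) ⟩
          ∏ (λ i → scaleFactor a (enum i) * nonzeroPart (enum i))  ≈⟨ ∑-distrib-+ (λ i → scaleFactor a (enum i)) (λ i → nonzeroPart (enum i)) ⟩
          K * P                                                   ∎
        factors : K * a ≈ a ↑ q
        factors = ∏-one-exception _ a (index 0#) (scaleFactor-zero (enum-index 0#))
          (λ i i≢ → scaleFactor-nonzero (λ eᵢ≈0 → i≢ (enum-inj _ _ (trans eᵢ≈0 (sym (enum-index 0#))))))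

    -- For a = 0 the claim is 0^q = 0 (q ≥ 1 since 0 is enumerated).
    fermat : ∀ a → a ↑ q ≈ a
    fermat a with a ≟ 0#
    ... | yes a≈0 = ↑-of-zero (index 0#) a≈0
    ... | no  a≉0 = fermat-unit a a≉0

  module FieldOfOrder2^ (m : ℕ) (isF : IsFieldOfOrder2^ (suc m) F) where
    open IsFieldOfOrder2^ isF
    open Characteristic2 char2
    open IntegralDomain 1≉0 (inverse⇒noZeroDivisors inverse)
    open FiniteField 1≉0 inverse _≟_ enum enum-inj enum-sur using (fermat)

    n : ℕ
    n = suc m

    -- Tr(a²) = Tr(a), because a^{2^n} = a.
    tr-square : ∀ a → tr n (a * a) ≈ tr n a
    tr-square a = add-cancelʳ a (trans (tr-square-shift n a) (+-congˡ (fermat a)))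

    tr-x+z² : ∀ x z → tr n (x + z * z) ≈ tr n x + tr n z
    tr-x+z² x z = trans (tr-+ n x (z * z)) (+-congˡ (tr-square z))

    tr-artinSchreier : ∀ t → tr n (t * t + t) ≈ 0#
    tr-artinSchreier t = trans (tr-+ n _ t) (trans (+-congʳ (tr-square t)) (x+x≈0 _))

    -- Tr is a monic polynomial of degree 2^m < 2^n, so it has a non-root.
    tr-not-identically-zero : ¬ (∀ i → tr n (enum i) ≈ 0#)
    tr-not-identically-zero allRoots = ℕₚ.<⇒≱ (ℕₚ.^-monoʳ-< 2 (s≤s (s≤s z≤n)) (ℕₚ.n<1+n m))
                                             (roots≤degree (tr-monic m) enum enum-inj allRoots)

    -- Some element has trace 1: a non-root of Tr has trace 1, since every
    -- trace value is idempotent, Tr(a)² = Tr(a²) = Tr(a).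
    tr-surjective : ∃ λ u → tr n u ≈ 1#
    tr-surjective with Finₚ.¬∀⟶∃¬ (2 ^ n) (λ i → tr n (enum i) ≈ 0#) (λ i → tr n (enum i) ≟ 0#) tr-not-identically-zero
    ... | i , tr≉0 = enum i , idempotent-nonzero⇒1 (trans (tr-squared n (enum i)) (tr-square (enum i))) tr≉0

    artinSchreier-solvable : ∀ {c} → tr n c ≈ 0# → ∃ λ t → t * t + t ≈ c
    artinSchreier-solvable {c} tr-c≈0 = root n , root-solves n (fermat u) tr-u≈1 tr-c≈0
      where
        u : Carrier
        u = proj₁ tr-surjective
        tr-u≈1 : tr n u ≈ 1#
        tr-u≈1 = proj₂ tr-surjective
        open ArtinSchreier c u

    kob-point⇒trace-condition : ∀ x → (∃ λ y → y * y + x * y ≈ x * x * x + 1#) →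
                                x ≈ 0# ⊎ (¬ x ≈ 0# × (∀ z → x * z ≈ 1# → tr n x ≈ tr n z))
    kob-point⇒trace-condition x (y , onCurve) with x ≟ 0#
    ... | yes x≈0 = inj₁ x≈0
    ... | no  x≉0 = inj₂ (x≉0 , λ z xz≈1 → sum≈0⇒≈ (begin
      tr n x + tr n z                    ≈⟨ sym (tr-x+z² x z) ⟩
      tr n (x + z * z)                   ≈⟨ tr-cong n (sym (curve⇒artinSchreier xz≈1 onCurve)) ⟩
      tr n ((y * z) * (y * z) + y * z)   ≈⟨ tr-artinSchreier (y * z) ⟩
      0#                                 ∎))

    trace-condition⇒kob-point : ∀ x → x ≈ 0# ⊎ (¬ x ≈ 0# × (∀ z → x * z ≈ 1# → tr n x ≈ tr n z)) →
                                ∃ λ y → y * y + x * y ≈ x * x * x + 1#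
    trace-condition⇒kob-point x (inj₁ x≈0) = 1# , curve-at-zero x≈0
    trace-condition⇒kob-point x (inj₂ (x≉0 , traces≈)) = x * t , artinSchreier⇒curve xz≈1 t-root
      where
        z : Carrier
        z = proj₁ (inverse x x≉0)
        xz≈1 : x * z ≈ 1#
        xz≈1 = proj₂ (inverse x x≉0)
        tr-x+z²≈0 : tr n (x + z * z) ≈ 0#
        tr-x+z²≈0 = trans (tr-x+z² x z) (trans (+-congʳ (traces≈ z xz≈1)) (x+x≈0 _))
        t : Carrier
        t = proj₁ (artinSchreier-solvable tr-x+z²≈0)
        t-root : t * t + t ≈ x + z * z
        t-root = proj₂ (artinSchreier-solvable tr-x+z²≈0)

mainTheorem2 : ∀ {c ℓ} (n : ℕ) → .{{_ : NonZero n}} →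
    (F : CommutativeRing c ℓ) → IsFieldOfOrder2^ n F →
    let open CommutativeRing F in
    ∀ (x : Carrier) →
      (∃ λ y → y * y + x * y ≈ x * x * x + 1#)
      ⇔ (x ≈ 0# ⊎ (¬ (x ≈ 0#) × (∀ z → x * z ≈ 1# → Tr F n x ≈ Tr F n z)))
mainTheorem2 (suc m) F isF x = mk⇔ (kob-point⇒trace-condition x) (trace-condition⇒kob-point x)
  where open FieldOfOrder2^ F m isF
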